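{- Let $(\alpha_n,\beta_n)$, $n\ge1$, be the $P$-positions $(x,y)$ with $0<x\le y$ of Corner the Queen Dee, listed so that $\alpha_1<\alpha_2<\cdots$, and put $\delta_n=\beta_n-\alpha_n$, $\sigma_n=\beta_n+\alpha_n$. Let $(a_n,b_n)$, $n\ge1$, be the $P$-positions $(x,y)$ with $0<x\le y$ of Corner the 2-Queen Dee, listed so that $a_1<a_2<\cdots$. Then for every $n\ge1$: $$a_n=\delta_n,\quad b_n=\sigma_n,\quad b_n-a_n=2\alpha_n,\quad b_n+a_n=2\beta_n.$$
   Context: Positions are pairs $(x,y)$ of nonnegative integers; every move strictly decreases $x+y$; $P$-positions are defined by: $(0,0)$ is a $P$-position, and a position is a $P$-position iff it has no move to a $P$-position. Queen Dee: from $(x,y)$ she may move to (i) $(x',y)$ with $0\le x'<x$ or $(x,y')$ with $0\le y'<y$; (ii) $(x-s,y-s)$ with $1\le s\le\min(x,y)$; (iii) reflected moves: if $x<y$, to $(t,y-x-t)$ with $0<t\le y-x$; if $x>y$, to $(x-y-t,t)$ with $0<t\le x-y$. 2-Queen Dee: from $(x,y)$ she may move to any position different from $(x,y)$ among: (i) $(x',y)$ with $0\le x'<x$, or $(x,y')$ with $0\le y'<y$; (ii) for each starting point $(u,v)\in\{(x,y),(x-1,y),(x,y-1)\}$ with $u,v\ge 0$: the positions $(u-s,v-s)$ with $0\le s\le\min(u,v)$, and, if $u<v$, the positions $(t,v-u-t)$ with $0<t\le v-u$, and, if $u>v$, the positions $(u-v-t,t)$ with $0<t\le u-v$. -}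

module Defs where

open import Data.Nat using (ℕ; zero; suc; _+_; _*_; _∸_; _≤_; _<_)
open import Data.Product using (_×_; Σ)
open import Relation.Nullary using (¬_)
open import Relation.Binary.PropositionalEquality using (_≡_)

-- A "move relation": Moves x y x' y' means (x,y) → (x',y') is a legal move.
MoveRel : Set₁
MoveRel = ℕ → ℕ → ℕ → ℕ → Set

data QueenDee (x y : ℕ) : ℕ → ℕ → Set where
  left  : ∀ {x'} → x' < x → QueenDee x y x' y
  down  : ∀ {y'} → y' < y → QueenDee x y x y'
  diag  : ∀ s → 1 ≤ s → s ≤ x → s ≤ y → QueenDee x y (x ∸ s) (y ∸ s)
  reflL : ∀ t → x < y → 0 < t → t ≤ y ∸ x → QueenDee x y t (y ∸ x ∸ t)
  reflR : ∀ t → y < x → 0 < t → t ≤ x ∸ y → QueenDee x y (x ∸ y ∸ t) t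

data Start : ℕ → ℕ → ℕ → ℕ → Set where
  here : ∀ {x y} → Start x y x y
  decx : ∀ {x y} → Start (suc x) y x y
  decy : ∀ {x y} → Start x (suc y) x y

-- Positions reachable from a starting point (u,v) by a (possibly null) diagonal
-- or a reflected move, as in clause (ii) of 2-Queen Dee.
data Reach (u v : ℕ) : ℕ → ℕ → Set where
  diag  : ∀ s → s ≤ u → s ≤ v → Reach u v (u ∸ s) (v ∸ s)
  reflL : ∀ t → u < v → 0 < t → t ≤ v ∸ u → Reach u v t (v ∸ u ∸ t)
  reflR : ∀ t → v < u → 0 < t → t ≤ u ∸ v → Reach u v (u ∸ v ∸ t) t

data TwoQueenDee (x y : ℕ) : ℕ → ℕ → Set where
  left  : ∀ {x'} → x' < x → TwoQueenDee x y x' y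
  down  : ∀ {y'} → y' < y → TwoQueenDee x y x y'
  queen : ∀ {u v x' y'} → Start x y u v → Reach u v x' y' →
          ¬ (x' ≡ x × y' ≡ y) → TwoQueenDee x y x' y'

-- P is the set of P-positions of the game with moves M:
-- (0,0) is a P-position, and a position is a P-position iff it has no move
-- to a P-position.  (Since every move decreases x+y, this determines P uniquely.)
IsPPositions : MoveRel → (ℕ → ℕ → Set) → Set
IsPPositions M P =
  P 0 0 ×
  (∀ x y → (P x y → ∀ x' y' → M x y x' y' → ¬ P x' y') ×
           ((∀ x' y' → M x y x' y' → ¬ P x' y') → P x y))

Enumerates : (ℕ → ℕ → Set) → (ℕ → ℕ) → (ℕ → ℕ) → Set
Enumerates P α β =
  (∀ m n → 1 ≤ m → m < n → α m < α n) ×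
  (∀ n → 1 ≤ n → P (α n) (β n) × 0 < α n × α n ≤ β n) ×
  (∀ x y → P x y → 0 < x → x ≤ y →
     Σ ℕ (λ n → 1 ≤ n × α n ≡ x × β n ≡ y))

{-# OPTIONS --safe #-}
module Submission where

-- The Queen Dee P-positions obey a Wythoff-type
-- recursion: α n is the mex of the α i, β i and δ n the mex of the δ i, σ i over i < n.
-- Hence δ is increasing, and every positive integer is some α i or β i, and also some δ i
-- or σ i. For 2-Queen Dee, the origin together with the pairs (δ i, σ i) in either order is
-- then stable and absorbing. A move between two such pairs would force a gap 2 α m (or,
-- from the shifted starting points, an odd gap) to equal 2 α k or 2 β k. Conversely, from
-- (δ m, y) with y < σ m, half the even part of y ∸ δ m is some α k or β k, and a diagonal
-- or reflected move reaches (δ k, σ k). So these are the 2-Queen Dee P-positions, and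
-- (δ, σ) is their (unique) enumeration.

open import Defs
open import Data.Nat using (ℕ; zero; suc; _+_; _*_; _∸_; _≤_; _<_; z≤n; s≤s; z<s; _≟_; _≤?_; _<?_)
open import Data.Nat.Properties
open import Data.Nat.Induction using (<-rec)
open import Data.Product using (_×_; _,_; proj₁; proj₂; ∃; ∃₂)
open import Data.Sum using (_⊎_; inj₁; inj₂; [_,_])
open import Data.Empty using (⊥-elim)
open import Relation.Nullary using (¬_; yes; no)
open import Relation.Nullary.Decidable using (_×-dec_; _⊎-dec_)
open import Relation.Binary.PropositionalEquality hiding ([_])
open import Relation.Binary.Definitions using (tri<; tri≈; tri>)
open import Data.Nat.Tactic.RingSolver using (solve-∀)

2*[1+n]≡2+2*n : ∀ n → 2 * suc n ≡ suc (suc (2 * n))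
2*[1+n]≡2+2*n = solve-∀

even⊎odd : ∀ n → ∃ λ j → n ≡ 2 * j ⊎ n ≡ suc (2 * j)
even⊎odd zero = 0 , inj₁ refl
even⊎odd (suc n) with even⊎odd n
... | j , inj₁ n≡2j    = j , inj₂ (cong suc n≡2j)
... | j , inj₂ n≡1+2j = suc j , inj₁ (trans (cong suc n≡1+2j) (sym (2*[1+n]≡2+2*n j)))

[m+o]∸[n+o]≡m∸n : ∀ m n o → (m + o) ∸ (n + o) ≡ m ∸ n
[m+o]∸[n+o]≡m∸n m n o = trans (cong₂ _∸_ (+-comm m o) (+-comm n o)) ([m+n]∸[m+o]≡n∸o o m n)

position-rec : (R : ℕ → ℕ → Set) →
               (∀ x y → (∀ {x' y'} → x' + y' < x + y → R x' y') → R x y) →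
               ∀ x y → R x y
position-rec R step x y = <-rec (λ s → ∀ x y → x + y ≡ s → R x y) go (x + y) x y refl
  where
  go : ∀ s → (∀ {s'} → s' < s → ∀ x y → x + y ≡ s' → R x y) → ∀ x y → x + y ≡ s → R x y
  go _ rec x y refl = step x y (λ lt → rec lt _ _ refl)

-- Off the axes every move shrinks x + y; on them it need not (a reflection from (0, y)
-- keeps the sum), which is why the axes are handled by the rook moves to the origin.
record CornerGame (M : MoveRel) : Set where
  field
    rook-left  : ∀ {x y x'} → x' < x → M x y x' y
    rook-down  : ∀ {x y y'} → y' < y → M x y x y'
    shrinks    : ∀ {x y x' y'} → M (suc x) (suc y) x' y' → x' + y' < suc x + suc y

module PPositions {M : MoveRel} (G : CornerGame M) {P : ℕ → ℕ → Set} (isP : IsPPositions M P) where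
  open CornerGame G

  P-origin : P 0 0
  P-origin = proj₁ isP

  P-stable : ∀ {x y x' y'} → P x y → M x y x' y' → ¬ P x' y'
  P-stable {x} {y} {x'} {y'} p = proj₁ (proj₂ isP x y) p x' y'

  P-intro : ∀ {x y} → (∀ {x' y'} → M x y x' y' → ¬ P x' y') → P x y
  P-intro {x} {y} h = proj₂ (proj₂ isP x y) (λ _ _ → h)

  P-axisʸ : ∀ {y} → P 0 y → y ≡ 0
  P-axisʸ {zero}  p = refl
  P-axisʸ {suc y} p = ⊥-elim (P-stable p (rook-down z<s) P-origin)

  P-axisˣ : ∀ {x} → P x 0 → x ≡ 0
  P-axisˣ {zero}  p = refl
  P-axisˣ {suc x} p = ⊥-elim (P-stable p (rook-left z<s) P-origin)

  P-functional : ∀ {x y y'} → P x y → P x y' → y ≡ y'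
  P-functional {y = y} {y'} p p' with <-cmp y y'
  ... | tri< y<y' _ _ = ⊥-elim (P-stable p' (rook-down y<y') p)
  ... | tri≈ _ y≡y' _ = y≡y'
  ... | tri> _ _ y>y' = ⊥-elim (P-stable p (rook-down y>y') p')

  P-swap : (∀ {x y x' y'} → M x y x' y' → M y x y' x') → ∀ {x y} → P x y → P y x
  P-swap swap {x} {y} = position-rec (λ x y → P x y → P y x) step x y
    where
    step : ∀ x y → (∀ {x' y'} → x' + y' < x + y → P x' y' → P y' x') → P x y → P y x
    step zero    y       _   p rewrite P-axisʸ p = P-origin
    step (suc x) zero    _   p rewrite P-axisˣ p = P-origin
    step (suc x) (suc y) rec p = P-intro λ {x'} {y'} m p' →
      P-stable p (swap m) (rec (subst (x' + y' <_) (+-comm (suc y) (suc x)) (shrinks m)) p')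

  P-characterisation :
    {Q : ℕ → ℕ → Set} → Q 0 0 → (∀ {y} → Q 0 y → y ≡ 0) → (∀ {x} → Q x 0 → x ≡ 0) →
    (∀ {x y x' y'} → Q x y → M x y x' y' → ¬ Q x' y') →
    (∀ x y → Q x y ⊎ ∃₂ λ x' y' → M x y x' y' × Q x' y') →
    ∀ x y → (P x y → Q x y) × (Q x y → P x y)
  P-characterisation {Q} Q-origin Q-axisʸ Q-axisˣ Q-stable Q-absorbing =
    position-rec (λ x y → (P x y → Q x y) × (Q x y → P x y)) step
    where
    step : ∀ x y → (∀ {x' y'} → x' + y' < x + y → (P x' y' → Q x' y') × (Q x' y' → P x' y')) →
           (P x y → Q x y) × (Q x y → P x y)
    step zero    y       _   = (λ p → subst (Q 0) (sym (P-axisʸ p)) Q-origin)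
                             , (λ q → subst (P 0) (sym (Q-axisʸ q)) P-origin)
    step (suc x) zero    _   = (λ p → subst (λ x → Q x 0) (sym (P-axisˣ p)) Q-origin)
                             , (λ q → subst (λ x → P x 0) (sym (Q-axisˣ q)) P-origin)
    step (suc x) (suc y) rec = P⇒Q , Q⇒P
      where
      P⇒Q : P (suc x) (suc y) → Q (suc x) (suc y)
      P⇒Q p with Q-absorbing (suc x) (suc y)
      ... | inj₁ q = q
      ... | inj₂ (_ , _ , m , q') = ⊥-elim (P-stable p m (proj₂ (rec (shrinks m)) q'))
      Q⇒P : Q (suc x) (suc y) → P (suc x) (suc y)
      Q⇒P q = P-intro λ m p' → Q-stable q m (proj₁ (rec (shrinks m)) p')

QueenDee-swap : ∀ {x y x' y'} → QueenDee x y x' y' → QueenDee y x y' x'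
QueenDee-swap (left x'<x)              = down x'<x
QueenDee-swap (down y'<y)              = left y'<y
QueenDee-swap (diag s 1≤s s≤x s≤y)     = diag s 1≤s s≤y s≤x
QueenDee-swap (reflL t x<y 0<t t≤y∸x) = reflR t x<y 0<t t≤y∸x
QueenDee-swap (reflR t y<x 0<t t≤x∸y) = reflL t y<x 0<t t≤x∸y

Start-swap : ∀ {x y u v} → Start x y u v → Start y x v u
Start-swap here = here
Start-swap decx = decy
Start-swap decy = decx

Reach-swap : ∀ {u v x' y'} → Reach u v x' y' → Reach v u y' x'
Reach-swap (diag s s≤u s≤v)          = diag s s≤v s≤u
Reach-swap (reflL t u<v 0<t t≤v∸u) = reflR t u<v 0<t t≤v∸u
Reach-swap (reflR t v<u 0<t t≤u∸v) = reflL t v<u 0<t t≤u∸v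

TwoQueenDee-swap : ∀ {x y x' y'} → TwoQueenDee x y x' y' → TwoQueenDee y x y' x'
TwoQueenDee-swap (left x'<x)     = down x'<x
TwoQueenDee-swap (down y'<y)     = left y'<y
TwoQueenDee-swap (queen st r ≢xy) =
  queen (Start-swap st) (Reach-swap r) (λ (y'≡y , x'≡x) → ≢xy (x'≡x , y'≡y))

Reach⇒QueenDee : ∀ {u v x' y'} → Reach u v x' y' → ¬ (x' ≡ u × y' ≡ v) → QueenDee u v x' y'
Reach⇒QueenDee (diag zero    _   _)   ≢uv = ⊥-elim (≢uv (refl , refl))
Reach⇒QueenDee (diag (suc s) s≤u s≤v) _   = diag (suc s) z<s s≤u s≤v
Reach⇒QueenDee (reflL t u<v 0<t t≤v∸u) _ = reflL t u<v 0<t t≤v∸u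
Reach⇒QueenDee (reflR t v<u 0<t t≤u∸v) _ = reflR t v<u 0<t t≤u∸v

Reach-sum : ∀ {u v x' y'} → Reach u v x' y' → x' + y' ≤ u + v
Reach-sum {u} {v} (diag s _ _) = +-mono-≤ (m∸n≤m u s) (m∸n≤m v s)
Reach-sum {u} {v} (reflL t _ _ t≤v∸u) = begin
  t + (v ∸ u ∸ t) ≡⟨ m+[n∸m]≡n t≤v∸u ⟩
  v ∸ u           ≤⟨ m∸n≤m v u ⟩
  v               ≤⟨ m≤n+m v u ⟩
  u + v           ∎
  where open ≤-Reasoning
Reach-sum {u} {v} (reflR t _ _ t≤u∸v) = begin
  (u ∸ v ∸ t) + t ≡⟨ m∸n+n≡m t≤u∸v ⟩
  u ∸ v           ≤⟨ m∸n≤m u v ⟩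
  u               ≤⟨ m≤m+n u v ⟩
  u + v           ∎
  where open ≤-Reasoning

QueenDee-shrinks : ∀ {x y x' y'} → QueenDee (suc x) (suc y) x' y' → x' + y' < suc x + suc y
QueenDee-shrinks {x} {y} (left x'<x) = +-monoˡ-< (suc y) x'<x
QueenDee-shrinks {x} {y} (down y'<y) = +-monoʳ-< (suc x) y'<y
QueenDee-shrinks {x} {y} (diag s 1≤s s≤x _) =
  +-mono-<-≤ (∸-monoʳ-< 1≤s s≤x) (m∸n≤m (suc y) s)
QueenDee-shrinks {x} {y} (reflL t _ _ t≤y∸x) = begin-strict
  t + (y ∸ x ∸ t) ≡⟨ m+[n∸m]≡n t≤y∸x ⟩
  y ∸ x           ≤⟨ m∸n≤m y x ⟩
  y               <⟨ m≤n+m (suc y) (suc x) ⟩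
  suc x + suc y   ∎
  where open ≤-Reasoning
QueenDee-shrinks {x} {y} (reflR t _ _ t≤x∸y) = begin-strict
  (x ∸ y ∸ t) + t ≡⟨ m∸n+n≡m t≤x∸y ⟩
  x ∸ y           ≤⟨ m∸n≤m x y ⟩
  x               <⟨ m≤m+n (suc x) (suc y) ⟩
  suc x + suc y   ∎
  where open ≤-Reasoning

TwoQueenDee-shrinks : ∀ {x y x' y'} → TwoQueenDee (suc x) (suc y) x' y' → x' + y' < suc x + suc y
TwoQueenDee-shrinks {x} {y} (left x'<x)        = +-monoˡ-< (suc y) x'<x
TwoQueenDee-shrinks {x} {y} (down y'<y)        = +-monoʳ-< (suc x) y'<y
TwoQueenDee-shrinks         (queen here r ≢xy) = QueenDee-shrinks (Reach⇒QueenDee r ≢xy)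
TwoQueenDee-shrinks         (queen decx r _)   = s≤s (Reach-sum r)
TwoQueenDee-shrinks {x} {y} (queen decy r _)   = ≤-trans (s≤s (Reach-sum r)) (≤-reflexive (sym (+-suc (suc x) y)))

queenDee : CornerGame QueenDee
queenDee = record { rook-left = left ; rook-down = down ; shrinks = QueenDee-shrinks }

twoQueenDee : CornerGame TwoQueenDee
twoQueenDee = record { rook-left = left ; rook-down = down ; shrinks = TwoQueenDee-shrinks }

Reach-diag : ∀ {u v x' y'} → x' ≤ u → y' ≤ v → u ∸ x' ≡ v ∸ y' → Reach u v x' y'
Reach-diag {u} {v} {x'} {y'} x'≤u y'≤v gap =
  subst₂ (Reach u v) (m∸[m∸n]≡n x'≤u) (trans (cong (v ∸_) gap) (m∸[m∸n]≡n y'≤v))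
    (diag (u ∸ x') (m∸n≤m u x') (subst (_≤ v) (sym gap) (m∸n≤m v y')))

Reach-reflL : ∀ {u v t y'} → u < v → 0 < t → t + y' ≡ v ∸ u → Reach u v t y'
Reach-reflL {u} {v} {t} {y'} u<v 0<t sum =
  subst (Reach u v t) (trans (cong (_∸ t) (sym sum)) (m+n∸m≡n t y'))
    (reflL t u<v 0<t (subst (t ≤_) sum (m≤m+n t y')))

module Enumeration {P : ℕ → ℕ → Set} {f g : ℕ → ℕ} (E : Enumerates P f g) where

  increasing : ∀ {m n} → 1 ≤ m → m < n → f m < f n
  increasing = proj₁ E _ _

  member : ∀ {n} → 1 ≤ n → P (f n) (g n)
  member 1≤n = proj₁ (proj₁ (proj₂ E) _ 1≤n)

  first-pos : ∀ {n} → 1 ≤ n → 0 < f n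
  first-pos 1≤n = proj₁ (proj₂ (proj₁ (proj₂ E) _ 1≤n))

  first≤second : ∀ {n} → 1 ≤ n → f n ≤ g n
  first≤second 1≤n = proj₂ (proj₂ (proj₁ (proj₂ E) _ 1≤n))

  complete : ∀ {x y} → P x y → 0 < x → x ≤ y → ∃ λ n → 1 ≤ n × f n ≡ x × g n ≡ y
  complete = proj₂ (proj₂ E) _ _

  reflects-< : ∀ {m n} → 1 ≤ n → f m < f n → m < n
  reflects-< {m} {n} 1≤n fm<fn with <-cmp m n
  ... | tri< m<n _ _ = m<n
  ... | tri≈ _ refl _ = ⊥-elim (<-irrefl refl fm<fn)
  ... | tri> _ _ m>n = ⊥-elim (<-asym fm<fn (increasing 1≤n m>n))

  injective : ∀ {m n} → 1 ≤ m → 1 ≤ n → f m ≡ f n → m ≡ n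
  injective {m} {n} 1≤m 1≤n fm≡fn with <-cmp m n
  ... | tri< m<n _ _ = ⊥-elim (<-irrefl fm≡fn (increasing 1≤m m<n))
  ... | tri≈ _ m≡n _ = m≡n
  ... | tri> _ _ m>n = ⊥-elim (<-irrefl (sym fm≡fn) (increasing 1≤n m>n))

  n≤f : ∀ {n} → 1 ≤ n → n ≤ f n
  n≤f {suc zero}    _ = first-pos (s≤s z≤n)
  n≤f {suc (suc n)} _ = ≤-<-trans (n≤f (s≤s z≤n)) (increasing (s≤s z≤n) ≤-refl)

enumeration-index-≤ : ∀ {P : ℕ → ℕ → Set} {f g f' g' : ℕ → ℕ} →
                      Enumerates P f g → Enumerates P f' g' →
                      ∀ {n m} → 1 ≤ n → 1 ≤ m → f' m ≡ f n → n ≤ m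
enumeration-index-≤ E E' {suc zero}    _ 1≤m _ = 1≤m
enumeration-index-≤ E E' {suc (suc n)} _ 1≤m f'm≡f[2+n] =
  let m' , 1≤m' , f'm'≡f[1+n] , _ = E'.complete (E.member 1≤1+n) (E.first-pos 1≤1+n) (E.first≤second 1≤1+n)
  in  ≤-<-trans (enumeration-index-≤ E E' 1≤1+n 1≤m' f'm'≡f[1+n])
        (E'.reflects-< 1≤m (subst₂ _<_ (sym f'm'≡f[1+n]) (sym f'm≡f[2+n]) (E.increasing 1≤1+n ≤-refl)))
  where
  module E  = Enumeration E
  module E' = Enumeration E'
  1≤1+n : 1 ≤ suc n
  1≤1+n = s≤s z≤n

enumeration-unique : ∀ {P : ℕ → ℕ → Set} {f g f' g' : ℕ → ℕ} →
                     Enumerates P f g → Enumerates P f' g' →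
                     ∀ n → 1 ≤ n → f n ≡ f' n × g n ≡ g' n
enumeration-unique E E' n 1≤n
  with Enumeration.complete E' (Enumeration.member E 1≤n)
         (Enumeration.first-pos E 1≤n) (Enumeration.first≤second E 1≤n)
... | m , 1≤m , f'm≡fn , g'm≡gn
  with ≤-antisym (enumeration-index-≤ E E' 1≤n 1≤m f'm≡fn)
                 (enumeration-index-≤ E' E 1≤m 1≤n (sym f'm≡fn))
... | refl = sym f'm≡fn , sym g'm≡gn

module QueenDeePositions {PQ : ℕ → ℕ → Set} (isPQ : IsPPositions QueenDee PQ)
                         {α β : ℕ → ℕ} (enumPQ : Enumerates PQ α β) where

  open PPositions queenDee isPQ
  open Enumeration enumPQ public
    renaming ( increasing to α-increasing; member to PQ[α,β]; first-pos to α-pos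
             ; first≤second to α≤β; complete to PQ-complete; reflects-< to α-reflects-<
             ; injective to α-injective; n≤f to n≤α)

  PQ-sym : ∀ {x y} → PQ x y → PQ y x
  PQ-sym = P-swap QueenDee-swap

  PQ-diagonal : ∀ {x} → PQ x x → x ≡ 0
  PQ-diagonal {zero}  _ = refl
  PQ-diagonal {suc x} p = ⊥-elim (P-stable p to-origin P-origin)
    where
    to-origin : QueenDee (suc x) (suc x) 0 0
    to-origin = subst₂ (QueenDee (suc x) (suc x)) (n∸n≡0 (suc x)) (n∸n≡0 (suc x))
                  (diag (suc x) z<s ≤-refl ≤-refl)

  PQ-origin⊎enumerated : ∀ {x y} → PQ x y → x ≤ y →
                         (x ≡ 0 × y ≡ 0) ⊎ ∃ λ i → 1 ≤ i × α i ≡ x × β i ≡ y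
  PQ-origin⊎enumerated {zero}  p _   = inj₁ (refl , P-axisʸ p)
  PQ-origin⊎enumerated {suc x} p x≤y = inj₂ (PQ-complete p z<s x≤y)

  δ σ : ℕ → ℕ
  δ i = β i ∸ α i
  σ i = β i + α i

  module _ {i : ℕ} (1≤i : 1 ≤ i) where

    β≡α+δ : β i ≡ α i + δ i
    β≡α+δ = sym (m+[n∸m]≡n (α≤β 1≤i))

    δ-pos : 1 ≤ δ i
    δ-pos with δ i ≟ 0
    ... | no  δ≢0 = n≢0⇒n>0 δ≢0
    ... | yes δ≡0 = ⊥-elim (n>0⇒n≢0 (α-pos 1≤i) (PQ-diagonal (subst (PQ (α i)) β≡α (PQ[α,β] 1≤i))))
      where
      β≡α : β i ≡ α i
      β≡α = trans β≡α+δ (trans (cong (α i +_) δ≡0) (+-identityʳ (α i)))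

    α<β : α i < β i
    α<β = subst (α i <_) (sym β≡α+δ) (subst (_≤ α i + δ i) (+-comm (α i) 1) (+-monoʳ-≤ (α i) δ-pos))

    σ≡δ+2α : σ i ≡ δ i + 2 * α i
    σ≡δ+2α = trans (cong (_+ α i) β≡α+δ) (lemma (α i) (δ i))
      where
      lemma : ∀ a d → a + d + a ≡ d + 2 * a
      lemma = solve-∀

    σ∸δ≡2α : σ i ∸ δ i ≡ 2 * α i
    σ∸δ≡2α = trans (cong (_∸ δ i) σ≡δ+2α) (m+n∸m≡n (δ i) (2 * α i))

    δ+σ≡2β : δ i + σ i ≡ 2 * β i
    δ+σ≡2β = trans (cong (δ i +_) σ≡δ+2α) (trans (lemma (α i) (δ i)) (cong (2 *_) (sym β≡α+δ)))
      where
      lemma : ∀ a d → d + (d + 2 * a) ≡ 2 * (a + d)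
      lemma = solve-∀

    δ<σ : δ i < σ i
    δ<σ = subst (δ i <_) (sym σ≡δ+2α)
            (subst (_≤ δ i + 2 * α i) (+-comm (δ i) 1) (+-monoʳ-≤ (δ i) (m≤n⇒m≤o*n 2 (α-pos 1≤i))))

    2α<σ : 2 * α i < σ i
    2α<σ = subst₂ _<_ (sym (cong (α i +_) (+-identityʳ (α i)))) (+-comm (α i) (β i)) (+-monoʳ-< (α i) α<β)

  α≢β : ∀ {k m} → 1 ≤ k → 1 ≤ m → α k ≢ β m
  α≢β {k} {m} 1≤k 1≤m αk≡βm = <-irrefl β≡α (α<β 1≤k)
    where
    βk≡αm : β k ≡ α m
    βk≡αm = P-functional (PQ[α,β] 1≤k) (subst (λ x → PQ x (α m)) (sym αk≡βm) (PQ-sym (PQ[α,β] 1≤m)))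
    β≡α : α k ≡ β k
    β≡α = ≤-antisym (α≤β 1≤k) (begin
      β k ≡⟨ βk≡αm ⟩
      α m ≤⟨ α≤β 1≤m ⟩
      β m ≡⟨ sym αk≡βm ⟩
      α k ∎)
      where open ≤-Reasoning

  <⇒δ≢δ : ∀ {k m} → 1 ≤ k → k < m → δ k ≢ δ m
  <⇒δ≢δ {k} {m} 1≤k k<m δk≡δm = P-stable (PQ[α,β] 1≤m) move (PQ[α,β] 1≤k)
    where
    1≤m : 1 ≤ m
    1≤m = ≤-trans 1≤k (<⇒≤ k<m)
    αk<αm : α k < α m
    αk<αm = α-increasing 1≤k k<m
    βk≡αk+δm : β k ≡ α k + δ m
    βk≡αk+δm = trans (β≡α+δ 1≤k) (cong (α k +_) δk≡δm)
    β-gap : β m ∸ β k ≡ α m ∸ α k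
    β-gap = begin
      β m ∸ β k                 ≡⟨ cong₂ _∸_ (β≡α+δ 1≤m) βk≡αk+δm ⟩
      (α m + δ m) ∸ (α k + δ m) ≡⟨ [m+o]∸[n+o]≡m∸n (α m) (α k) (δ m) ⟩
      α m ∸ α k                 ∎
      where open ≡-Reasoning
    βk≤βm : β k ≤ β m
    βk≤βm = subst₂ _≤_ (sym βk≡αk+δm) (sym (β≡α+δ 1≤m)) (+-monoˡ-≤ (δ m) (<⇒≤ αk<αm))
    move : QueenDee (α m) (β m) (α k) (β k)
    move = Reach⇒QueenDee (Reach-diag (<⇒≤ αk<αm) βk≤βm (sym β-gap))
             (λ (αk≡αm , _) → <-irrefl αk≡αm αk<αm)

  δ-injective : ∀ {k m} → 1 ≤ k → 1 ≤ m → δ k ≡ δ m → k ≡ m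
  δ-injective {k} {m} 1≤k 1≤m δk≡δm with <-cmp k m
  ... | tri< k<m _ _ = ⊥-elim (<⇒δ≢δ 1≤k k<m δk≡δm)
  ... | tri≈ _ k≡m _ = k≡m
  ... | tri> _ _ k>m = ⊥-elim (<⇒δ≢δ 1≤m k>m (sym δk≡δm))

  δ≢σ : ∀ {k m} → 1 ≤ k → 1 ≤ m → δ k ≢ σ m
  δ≢σ {k} {m} 1≤k 1≤m δk≡σm = P-stable (PQ[α,β] 1≤k) move (PQ[α,β] 1≤m)
    where
    move : QueenDee (α k) (β k) (α m) (β m)
    move = Reach⇒QueenDee (Reach-reflL (α<β 1≤k) (α-pos 1≤m) (trans (+-comm (α m) (β m)) (sym δk≡σm)))
             λ (αm≡αk , _) → <-irrefl (trans δk≡σm (cong σ (α-injective 1≤m 1≤k αm≡αk))) (δ<σ 1≤k)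

  PQ-sum : ∀ {x y} → PQ x y → 0 < x → ∃ λ i → 1 ≤ i × σ i ≡ x + y
  PQ-sum {x} {y} p 0<x with ≤-total x y
  ... | inj₁ x≤y with PQ-complete p 0<x x≤y
  ...   | i , 1≤i , refl , refl = i , 1≤i , +-comm (β i) (α i)
  PQ-sum {x} {y} p 0<x | inj₂ y≤x with PQ-origin⊎enumerated (PQ-sym p) y≤x
  ...   | inj₁ (_ , x≡0) = ⊥-elim (n>0⇒n≢0 0<x x≡0)
  ...   | inj₂ (i , 1≤i , refl , refl) = i , 1≤i , refl

  PQ-criterion : ∀ {j e} → 1 ≤ e →
                 (∀ {y} → y < j + e → ¬ PQ j y) →
                 (∀ {i} → 1 ≤ i → α i < j → δ i < e) →
                 (∀ {i} → 1 ≤ i → σ i ≢ e) →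
                 PQ j (j + e)
  PQ-criterion {j} {e} 1≤e no-P-below δ<e σ≢e = P-intro no-P-move
    where
    no-P-with-gap : ∀ {x d} → x < j → e ≤ d → ¬ PQ x (x + d)
    no-P-with-gap {x} {d} x<j e≤d p with PQ-origin⊎enumerated p (m≤m+n x d)
    ... | inj₁ (refl , d≡0) = n>0⇒n≢0 (≤-trans 1≤e e≤d) d≡0
    ... | inj₂ (i , 1≤i , αi≡x , βi≡x+d) =
          ≤⇒≯ e≤δi (δ<e 1≤i (subst (_< j) (sym αi≡x) x<j))
      where
      e≤δi : e ≤ δ i
      e≤δi = subst (e ≤_) (sym (trans (cong₂ _∸_ βi≡x+d αi≡x) (m+n∸m≡n x d))) e≤d

    no-P-move : ∀ {x' y'} → QueenDee j (j + e) x' y' → ¬ PQ x' y'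
    no-P-move (left {x'} x'<j) p =
      no-P-with-gap x'<j e≤gap (subst (PQ x') (sym (m+[n∸m]≡n x'≤j+e)) p)
      where
      x'≤j+e : x' ≤ j + e
      x'≤j+e = ≤-trans (<⇒≤ x'<j) (m≤m+n j e)
      e≤gap : e ≤ (j + e) ∸ x'
      e≤gap = subst (e ≤_) (sym (+-∸-comm e (<⇒≤ x'<j))) (m≤n+m e (j ∸ x'))
    no-P-move (down y'<j+e) p = no-P-below y'<j+e p
    no-P-move (diag s 1≤s s≤j _) p =
      no-P-with-gap (∸-monoʳ-< 1≤s s≤j) ≤-refl (subst (PQ (j ∸ s)) (+-∸-comm e s≤j) p)
    no-P-move (reflL t _ 0<t t≤e) p with PQ-sum p 0<t
    ... | i , 1≤i , σi≡sum = σ≢e 1≤i (trans σi≡sum (trans (m+[n∸m]≡n t≤e) (m+n∸m≡n j e)))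
    no-P-move (reflR _ j+e<j _ _) _ = ≤⇒≯ (m≤m+n j e) j+e<j

  σ-gap : ∀ {i i'} → 1 ≤ i → i < i' → δ i < δ i' → 2 + σ i ≤ σ i'
  σ-gap {i} {i'} 1≤i i<i' δi<δi' = +-mono-≤ β-gap (<⇒≤ αi<αi')
    where
    αi<αi' : α i < α i'
    αi<αi' = α-increasing 1≤i i<i'
    β-gap : 2 + β i ≤ β i'
    β-gap = begin
      2 + β i               ≡⟨ cong (2 +_) (β≡α+δ 1≤i) ⟩
      2 + (α i + δ i)       ≡⟨ cong suc (sym (+-suc (α i) (δ i))) ⟩
      suc (α i) + suc (δ i) ≤⟨ +-mono-≤ αi<αi' δi<δi' ⟩
      α i' + δ i'           ≡⟨ sym (β≡α+δ (≤-trans 1≤i (<⇒≤ i<i'))) ⟩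
      β i'                  ∎
      where open ≤-Reasoning

  ABCovered DSCovered : ℕ → ℕ → Set
  ABCovered n j = ∃ λ i → i < n × 1 ≤ i × (α i ≡ j ⊎ β i ≡ j)
  DSCovered n e = ∃ λ i → i < n × 1 ≤ i × (δ i ≡ e ⊎ σ i ≡ e)

  -- The bound δ n < 2 n keeps every later σ i > 2 α i ≥ 2 i away from the next mex.
  record MexInvariant (n : ℕ) : Set where
    field
      α-mex : ∀ {j} → 1 ≤ j → j < α n → ABCovered n j
      δ-mex : ∀ {e} → 1 ≤ e → e < δ n → DSCovered n e
      δ-max : ∀ {i} → 1 ≤ i → i < n → δ i < δ n
      δ<2n  : δ n < 2 * n

  record NextDifference (n e : ℕ) : Set where
    field
      1≤e   : 1 ≤ e
      δ<e   : ∀ {i} → 1 ≤ i → i < n → δ i < e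
      σ≢e   : ∀ {i} → 1 ≤ i → i < n → σ i ≢ e
      e-mex : ∀ {e'} → 1 ≤ e' → e' < e → DSCovered n e'
      e<2n  : e < 2 * n

  module _ {n e} (1≤n : 1 ≤ n) (next : NextDifference n e) where
    open NextDifference next

    σ≢next : ∀ {i} → 1 ≤ i → σ i ≢ e
    σ≢next {i} 1≤i with i <? n
    ... | yes i<n = σ≢e 1≤i i<n
    ... | no  i≮n = λ σi≡e → <-irrefl (sym σi≡e) e<σi
      where
      e<σi : e < σ i
      e<σi = begin-strict
        e       <⟨ e<2n ⟩
        2 * n   ≤⟨ *-monoʳ-≤ 2 (≤-trans (≮⇒≥ i≮n) (n≤α 1≤i)) ⟩
        2 * α i <⟨ 2α<σ 1≤i ⟩
        σ i     ∎
        where open ≤-Reasoning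

    δ<next-before : ∀ {i j} → 1 ≤ i → α i < j → j ≤ α n → δ i < e
    δ<next-before 1≤i αi<j j≤αn = δ<e 1≤i (α-reflects-< 1≤n (<-≤-trans αi<j j≤αn))

    no-P-below-next : ∀ {y} → y < α n + e → ¬ PQ (α n) y
    no-P-below-next {y} y<αn+e p with ≤-total (α n) y
    ... | inj₂ y≤αn with PQ-origin⊎enumerated (PQ-sym p) y≤αn
    ...   | inj₁ (_ , αn≡0) = n>0⇒n≢0 (α-pos 1≤n) αn≡0
    ...   | inj₂ (i , 1≤i , _ , βi≡αn) = α≢β 1≤n 1≤i (sym βi≡αn)
    no-P-below-next {y} y<αn+e p | inj₁ αn≤y with PQ-complete p (α-pos 1≤n) αn≤y
    ... | i , 1≤i , αi≡αn , βi≡y with α-injective 1≤i 1≤n αi≡αn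
    ...   | refl with e-mex (δ-pos 1≤n) δn<e
      where
      δn<e : δ n < e
      δn<e = subst₂ _<_ (cong (_∸ α n) (sym βi≡y)) (m+n∸m≡n (α n) e) (∸-monoˡ-< y<αn+e αn≤y)
    ...     | i' , i'<n , 1≤i' , inj₁ δi'≡δn = <-irrefl (δ-injective 1≤i' 1≤n δi'≡δn) i'<n
    ...     | i' , i'<n , 1≤i' , inj₂ σi'≡δn = δ≢σ 1≤n 1≤i' (sym σi'≡δn)

    δ≡next : δ n ≡ e
    δ≡next = trans (cong (_∸ α n) βn≡αn+e) (m+n∸m≡n (α n) e)
      where
      βn≡αn+e : β n ≡ α n + e
      βn≡αn+e = P-functional (PQ[α,β] 1≤n)
        (PQ-criterion 1≤e no-P-below-next (λ 1≤i αi<αn → δ<next-before 1≤i αi<αn ≤-refl) σ≢next)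

    α-mex-next : ∀ {j} → 1 ≤ j → j < α n → ABCovered n j
    α-mex-next {j} 1≤j j<αn with anyUpTo? (λ i → (1 ≤? i) ×-dec ((α i ≟ j) ⊎-dec (β i ≟ j))) n
    ... | yes covered  = covered
    ... | no uncovered = ⊥-elim (no-P-in-row Pj)
      where
      not-covered : ∀ {i} → 1 ≤ i → α i < α n → ¬ (α i ≡ j ⊎ β i ≡ j)
      not-covered {i} 1≤i αi<αn c = uncovered (i , α-reflects-< 1≤n αi<αn , 1≤i , c)
      no-P-in-row : ∀ {y} → ¬ PQ j y
      no-P-in-row {y} p with ≤-total j y
      ... | inj₁ j≤y with PQ-complete p 1≤j j≤y
      ...   | i , 1≤i , αi≡j , _ = not-covered 1≤i (subst (_< α n) (sym αi≡j) j<αn) (inj₁ αi≡j)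
      no-P-in-row {y} p | inj₂ y≤j with PQ-origin⊎enumerated (PQ-sym p) y≤j
      ...   | inj₁ (_ , j≡0) = n>0⇒n≢0 1≤j j≡0
      ...   | inj₂ (i , 1≤i , αi≡y , βi≡j) =
              not-covered 1≤i (≤-<-trans (subst (_≤ j) (sym αi≡y) y≤j) j<αn) (inj₂ βi≡j)
      Pj : PQ j (j + e)
      Pj = PQ-criterion 1≤e (λ _ → no-P-in-row) (λ 1≤i αi<j → δ<next-before 1≤i αi<j (<⇒≤ j<αn)) σ≢next

    mex-invariant-from-next : MexInvariant n
    mex-invariant-from-next = record
      { α-mex = α-mex-next
      ; δ-mex = λ 1≤e' e'<δn → e-mex 1≤e' (subst (_ <_) δ≡next e'<δn)
      ; δ-max = λ 1≤i i<n → subst (δ _ <_) (sym δ≡next) (δ<e 1≤i i<n)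
      ; δ<2n  = subst (_< 2 * n) (sym δ≡next) e<2n
      }

  DSCovered-suc : ∀ {n e} → DSCovered n e → DSCovered (suc n) e
  DSCovered-suc (i , i<n , covered) = i , m<n⇒m<1+n i<n , covered

  σ-not-adjacent : ∀ {n} → (∀ {i i'} → 1 ≤ i → i < i' → i' < n → δ i < δ i') →
                   ∀ {i i'} → 1 ≤ i → 1 ≤ i' → i < n → i' < n → σ i ≢ suc (σ i')
  σ-not-adjacent δ-increasing-below {i} {i'} 1≤i 1≤i' i<n i'<n σi≡1+σi' with <-cmp i i'
  ... | tri< i<i' _ _ = <⇒≱ (subst (σ i' <_) (sym σi≡1+σi') (n<1+n (σ i')))
                           (≤-trans (m≤n+m (σ i) 2) (σ-gap 1≤i i<i' (δ-increasing-below 1≤i i<i' i'<n)))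
  ... | tri≈ _ refl _ = <-irrefl σi≡1+σi' (n<1+n (σ i))
  ... | tri> _ _ i>i' = ≤⇒≯ (σ-gap 1≤i' i>i' (δ-increasing-below 1≤i' i>i' i<n))
                           (subst (_< 2 + σ i') (sym σi≡1+σi') (n<1+n (suc (σ i'))))

  module _ {k} (1≤k : 1 ≤ k) (inv : MexInvariant k) where
    open MexInvariant inv

    δ≤δ-last : ∀ {i} → 1 ≤ i → i < suc k → δ i ≤ δ k
    δ≤δ-last 1≤i i<1+k with m<1+n⇒m<n∨m≡n i<1+k
    ... | inj₁ i<k  = <⇒≤ (δ-max 1≤i i<k)
    ... | inj₂ refl = ≤-refl

    covered-up-to-δ-last : ∀ {e'} → 1 ≤ e' → e' ≤ δ k → DSCovered (suc k) e'
    covered-up-to-δ-last 1≤e' e'≤δk with m≤n⇒m<n∨m≡n e'≤δk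
    ... | inj₁ e'<δk = DSCovered-suc (δ-mex 1≤e' e'<δk)
    ... | inj₂ refl  = k , ≤-refl , 1≤k , inj₁ refl

    next-δ+1 : (∀ {i} → 1 ≤ i → i < suc k → σ i ≢ suc (δ k)) → NextDifference (suc k) (suc (δ k))
    next-δ+1 σ≢1+δk = record
      { 1≤e   = s≤s z≤n
      ; δ<e   = λ 1≤i i<1+k → s≤s (δ≤δ-last 1≤i i<1+k)
      ; σ≢e   = σ≢1+δk
      ; e-mex = λ 1≤e' e'<1+δk → covered-up-to-δ-last 1≤e' (≤-pred e'<1+δk)
      ; e<2n  = subst (suc (suc (δ k)) ≤_) (sym (2*[1+n]≡2+2*n k)) (s≤s (m≤n⇒m≤1+n δ<2n))
      }

    next-δ+2 : (∀ {i i'} → 1 ≤ i → i < i' → i' < suc k → δ i < δ i') →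
               ∀ {i₀} → 1 ≤ i₀ → i₀ < suc k → σ i₀ ≡ suc (δ k) →
               NextDifference (suc k) (suc (suc (δ k)))
    next-δ+2 δ-increasing-below {i₀} 1≤i₀ i₀<1+k σi₀≡1+δk = record
      { 1≤e   = s≤s z≤n
      ; δ<e   = λ 1≤i i<1+k → s≤s (m≤n⇒m≤1+n (δ≤δ-last 1≤i i<1+k))
      ; σ≢e   = λ 1≤i i<1+k σi≡2+δk → σ-not-adjacent δ-increasing-below 1≤i 1≤i₀ i<1+k i₀<1+k
                                        (trans σi≡2+δk (cong suc (sym σi₀≡1+δk)))
      ; e-mex = e-mex
      ; e<2n  = subst (suc (suc (suc (δ k))) ≤_) (sym (2*[1+n]≡2+2*n k)) (s≤s (s≤s δ<2n))
      }
      where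
      e-mex : ∀ {e'} → 1 ≤ e' → e' < suc (suc (δ k)) → DSCovered (suc k) e'
      e-mex 1≤e' e'<2+δk with m<1+n⇒m<n∨m≡n e'<2+δk
      ... | inj₁ e'<1+δk = covered-up-to-δ-last 1≤e' (≤-pred e'<1+δk)
      ... | inj₂ refl    = i₀ , i₀<1+k , 1≤i₀ , inj₂ σi₀≡1+δk

  next-difference : ∀ {n} → 1 ≤ n → (∀ {k} → 1 ≤ k → k < n → MexInvariant k) → ∃ (NextDifference n)
  next-difference {suc zero} _ _ = 1 , record
    { 1≤e   = s≤s z≤n
    ; δ<e   = λ { (s≤s _) (s≤s ()) }
    ; σ≢e   = λ { (s≤s _) (s≤s ()) }
    ; e-mex = λ { (s≤s _) (s≤s ()) }
    ; e<2n  = ≤-refl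
    }
  next-difference {suc (suc k)} _ invariant
    with anyUpTo? (λ i → (1 ≤? i) ×-dec (σ i ≟ suc (δ (suc k)))) (suc (suc k))
  ... | no  ¬σ≡ = _ , next-δ+1 (s≤s z≤n) (invariant (s≤s z≤n) ≤-refl)
                        (λ {i} 1≤i i<n σi≡ → ¬σ≡ (i , i<n , 1≤i , σi≡))
  ... | yes (i₀ , i₀<n , 1≤i₀ , σi₀≡) = _ , next-δ+2 (s≤s z≤n) (invariant (s≤s z≤n) ≤-refl)
          (λ 1≤i i<i' i'<n → MexInvariant.δ-max (invariant (≤-trans 1≤i (<⇒≤ i<i')) i'<n) 1≤i i<i')
          1≤i₀ i₀<n σi₀≡

  mex-invariant : ∀ {n} → 1 ≤ n → MexInvariant n
  mex-invariant {n} = <-rec (λ n → 1 ≤ n → MexInvariant n) step n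
    where
    step : ∀ n → (∀ {k} → k < n → 1 ≤ k → MexInvariant k) → 1 ≤ n → MexInvariant n
    step n rec 1≤n = mex-invariant-from-next 1≤n (proj₂ (next-difference 1≤n (λ 1≤k k<n → rec k<n 1≤k)))

  δ-increasing : ∀ {k m} → 1 ≤ k → k < m → δ k < δ m
  δ-increasing 1≤k k<m = MexInvariant.δ-max (mex-invariant (≤-trans 1≤k (<⇒≤ k<m))) 1≤k k<m

  n≤δ : ∀ {n} → 1 ≤ n → n ≤ δ n
  n≤δ {suc zero}    1≤n = δ-pos 1≤n
  n≤δ {suc (suc n)} _   = ≤-<-trans (n≤δ (s≤s z≤n)) (δ-increasing (s≤s z≤n) ≤-refl)

  α⊎β-cover : ∀ {j} → 1 ≤ j → ∃ λ i → 1 ≤ i × (α i ≡ j ⊎ β i ≡ j)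
  α⊎β-cover {j} 1≤j with MexInvariant.α-mex (mex-invariant (s≤s z≤n)) 1≤j (n≤α (s≤s z≤n))
  ... | i , _ , 1≤i , covered = i , 1≤i , covered

  δ⊎σ-cover : ∀ {e} → 1 ≤ e → ∃ λ i → 1 ≤ i × (δ i ≡ e ⊎ σ i ≡ e)
  δ⊎σ-cover {e} 1≤e with MexInvariant.δ-mex (mex-invariant (s≤s z≤n)) 1≤e (n≤δ (s≤s z≤n))
  ... | i , _ , 1≤i , covered = i , 1≤i , covered

  σ-increasing : ∀ {k m} → 1 ≤ k → k < m → σ k < σ m
  σ-increasing 1≤k k<m = ≤-trans (n≤1+n _) (σ-gap 1≤k k<m (δ-increasing 1≤k k<m))

  σ-injective : ∀ {k m} → 1 ≤ k → 1 ≤ m → σ k ≡ σ m → k ≡ m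
  σ-injective {k} {m} 1≤k 1≤m σk≡σm with <-cmp k m
  ... | tri< k<m _ _ = ⊥-elim (<-irrefl σk≡σm (σ-increasing 1≤k k<m))
  ... | tri≈ _ k≡m _ = k≡m
  ... | tri> _ _ k>m = ⊥-elim (<-irrefl (sym σk≡σm) (σ-increasing 1≤m k>m))

module TwoQueenDeePositions {PQ : ℕ → ℕ → Set} (isPQ : IsPPositions QueenDee PQ)
                            {α β : ℕ → ℕ} (enumPQ : Enumerates PQ α β)
                            {P2 : ℕ → ℕ → Set} (isP2 : IsPPositions TwoQueenDee P2) where

  open QueenDeePositions isPQ enumPQ

  data ΔΣ (x y : ℕ) : Set where
    origin       : x ≡ 0 → y ≡ 0 → ΔΣ x y
    pair         : ∀ {i} → 1 ≤ i → δ i ≡ x → σ i ≡ y → ΔΣ x y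
    pair-swapped : ∀ {i} → 1 ≤ i → σ i ≡ x → δ i ≡ y → ΔΣ x y

  ΔΣ-swap : ∀ {x y} → ΔΣ x y → ΔΣ y x
  ΔΣ-swap (origin x≡0 y≡0)        = origin y≡0 x≡0
  ΔΣ-swap (pair 1≤i δi≡x σi≡y)    = pair-swapped 1≤i σi≡y δi≡x
  ΔΣ-swap (pair-swapped 1≤i σi≡x δi≡y) = pair 1≤i δi≡y σi≡x

  ΔΣ-axisʸ : ∀ {y} → ΔΣ 0 y → y ≡ 0
  ΔΣ-axisʸ (origin _ y≡0)          = y≡0
  ΔΣ-axisʸ (pair 1≤i δi≡0 _)       = ⊥-elim (n>0⇒n≢0 (δ-pos 1≤i) δi≡0)
  ΔΣ-axisʸ (pair-swapped 1≤i σi≡0 _) = ⊥-elim (n>0⇒n≢0 (≤-<-trans z≤n (δ<σ 1≤i)) σi≡0)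

  ΔΣ-axisˣ : ∀ {x} → ΔΣ x 0 → x ≡ 0
  ΔΣ-axisˣ q = ΔΣ-axisʸ (ΔΣ-swap q)

  Reach-ΔΣ : ∀ {u v x' y'} → u < v → Reach u v x' y' → ΔΣ x' y' →
             (∃ λ k → 1 ≤ k × δ k ≡ x' × σ k ≡ y' × 2 * α k ≡ v ∸ u) ⊎
             (∃ λ k → 1 ≤ k × 2 * β k ≡ v ∸ u)
  Reach-ΔΣ {u} {v} u<v (diag s s≤u _) q with q
  ... | origin _ v∸s≡0 = ⊥-elim (n>0⇒n≢0 (≤-<-trans z≤n (∸-monoˡ-< u<v s≤u)) v∸s≡0)
  ... | pair {k} 1≤k δk≡u∸s σk≡v∸s = inj₁ (k , 1≤k , δk≡u∸s , σk≡v∸s , (begin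
        2 * α k               ≡⟨ sym (σ∸δ≡2α 1≤k) ⟩
        σ k ∸ δ k             ≡⟨ cong₂ _∸_ σk≡v∸s δk≡u∸s ⟩
        (v ∸ s) ∸ (u ∸ s)     ≡⟨ ∸-+-assoc v s (u ∸ s) ⟩
        v ∸ (s + (u ∸ s))     ≡⟨ cong (v ∸_) (m+[n∸m]≡n s≤u) ⟩
        v ∸ u                 ∎))
    where open ≡-Reasoning
  ... | pair-swapped 1≤k σk≡u∸s δk≡v∸s =
        ⊥-elim (<-asym (δ<σ 1≤k) (subst₂ _<_ (sym σk≡u∸s) (sym δk≡v∸s) (∸-monoˡ-< u<v s≤u)))
  Reach-ΔΣ u<v (reflL t _ 0<t t≤v∸u) (origin t≡0 _) = ⊥-elim (n>0⇒n≢0 0<t t≡0)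
  Reach-ΔΣ u<v (reflL t _ 0<t t≤v∸u) (pair {k} 1≤k δk≡t σk≡rest) =
    inj₂ (k , 1≤k , trans (sym (δ+σ≡2β 1≤k)) (trans (cong₂ _+_ δk≡t σk≡rest) (m+[n∸m]≡n t≤v∸u)))
  Reach-ΔΣ u<v (reflL t _ 0<t t≤v∸u) (pair-swapped {k} 1≤k σk≡t δk≡rest) =
    inj₂ (k , 1≤k , trans (sym (δ+σ≡2β 1≤k))
                      (trans (+-comm (δ k) (σ k)) (trans (cong₂ _+_ σk≡t δk≡rest) (m+[n∸m]≡n t≤v∸u))))
  Reach-ΔΣ u<v (reflR _ v<u _ _) _ = ⊥-elim (<-asym u<v v<u)

  odd-gap-¬ΔΣ : ∀ {u v x' y'} c → v ≡ u + suc (2 * c) → Reach u v x' y' → ¬ ΔΣ x' y'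
  odd-gap-¬ΔΣ {u} {v} c v≡u+odd r q =
    [ (λ (k , _ , _ , _ , 2αk≡gap) → even≢odd (α k) c (trans 2αk≡gap gap))
    , (λ (k , _ , 2βk≡gap) → even≢odd (β k) c (trans 2βk≡gap gap))
    ] (Reach-ΔΣ u<v r q)
    where
    u<v : u < v
    u<v = subst (u <_) (sym v≡u+odd) (m<m+n u z<s)
    gap : v ∸ u ≡ suc (2 * c)
    gap = trans (cong (_∸ u) v≡u+odd) (m+n∸m≡n u _)

  no-move-from-origin : ∀ {x' y'} → ¬ TwoQueenDee 0 0 x' y'
  no-move-from-origin (left ())
  no-move-from-origin (down ())
  no-move-from-origin (queen here (diag zero _ _) ≢00) = ≢00 (refl , refl)
  no-move-from-origin (queen here (diag (suc s) () _) _)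
  no-move-from-origin (queen here (reflL _ () _ _) _)
  no-move-from-origin (queen here (reflR _ () _ _) _)

  pair-stable-left : ∀ {m x y x'} → 1 ≤ m → δ m ≡ x → σ m ≡ y → x' < x → ¬ ΔΣ x' y
  pair-stable-left 1≤m refl refl x'<δm (origin _ σm≡0) = n>0⇒n≢0 (≤-<-trans z≤n (δ<σ 1≤m)) σm≡0
  pair-stable-left 1≤m refl refl x'<δm (pair 1≤k δk≡x' σk≡σm) with σ-injective 1≤k 1≤m σk≡σm
  ... | refl = <-irrefl (sym δk≡x') x'<δm
  pair-stable-left 1≤m refl refl _ (pair-swapped 1≤k _ δk≡σm) = δ≢σ 1≤k 1≤m δk≡σm

  pair-stable-down : ∀ {m x y y'} → 1 ≤ m → δ m ≡ x → σ m ≡ y → y' < y → ¬ ΔΣ x y'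
  pair-stable-down 1≤m refl refl y'<σm (origin δm≡0 _) = n>0⇒n≢0 (δ-pos 1≤m) δm≡0
  pair-stable-down 1≤m refl refl y'<σm (pair 1≤k δk≡δm σk≡y') with δ-injective 1≤k 1≤m δk≡δm
  ... | refl = <-irrefl (sym σk≡y') y'<σm
  pair-stable-down 1≤m refl refl _ (pair-swapped 1≤k σk≡δm _) = δ≢σ 1≤m 1≤k (sym σk≡δm)

  pair-stable-here : ∀ {m x y x' y'} → 1 ≤ m → δ m ≡ x → σ m ≡ y →
                     Reach x y x' y' → ¬ (x' ≡ x × y' ≡ y) → ¬ ΔΣ x' y'
  pair-stable-here {m} 1≤m refl refl r ≢δσ q with Reach-ΔΣ (δ<σ 1≤m) r q
  ... | inj₁ (k , 1≤k , δk≡x' , σk≡y' , 2αk≡2αm)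
      with α-injective 1≤k 1≤m (*-cancelˡ-≡ (α k) (α m) 2 (trans 2αk≡2αm (σ∸δ≡2α 1≤m)))
  ...   | refl = ≢δσ (sym δk≡x' , sym σk≡y')
  pair-stable-here {m} 1≤m refl refl r ≢δσ q | inj₂ (k , 1≤k , 2βk≡2αm) =
    α≢β 1≤m 1≤k (*-cancelˡ-≡ (α m) (β k) 2 (trans (sym (σ∸δ≡2α 1≤m)) (sym 2βk≡2αm)))

  pair-stable : ∀ {m x y x' y'} → 1 ≤ m → δ m ≡ x → σ m ≡ y →
                TwoQueenDee x y x' y' → ¬ ΔΣ x' y'
  pair-stable 1≤m δm≡x σm≡y (left x'<x)        = pair-stable-left 1≤m δm≡x σm≡y x'<x
  pair-stable 1≤m δm≡x σm≡y (down y'<y)        = pair-stable-down 1≤m δm≡x σm≡y y'<y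
  pair-stable 1≤m δm≡x σm≡y (queen here r ≢xy) = pair-stable-here 1≤m δm≡x σm≡y r ≢xy
  pair-stable {m} {suc u} 1≤m δm≡1+u refl (queen decx r _) = odd-gap-¬ΔΣ (α m) σm≡u+odd r
    where
    σm≡u+odd : σ m ≡ u + suc (2 * α m)
    σm≡u+odd = trans (σ≡δ+2α 1≤m) (trans (cong (_+ 2 * α m) δm≡1+u) (sym (+-suc u (2 * α m))))
  pair-stable {m} {y = suc v} 1≤m refl σm≡1+v (queen decy r _) = odd-gap-¬ΔΣ c v≡δm+odd r
    where
    c = α m ∸ 1
    v≡δm+odd : v ≡ δ m + suc (2 * c)
    v≡δm+odd = suc-injective (begin
      suc v                     ≡⟨ sym σm≡1+v ⟩
      σ m                       ≡⟨ σ≡δ+2α 1≤m ⟩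
      δ m + 2 * α m             ≡⟨ cong (λ a → δ m + 2 * a) (sym (m+[n∸m]≡n (α-pos 1≤m))) ⟩
      δ m + 2 * suc c           ≡⟨ cong (δ m +_) (2*[1+n]≡2+2*n c) ⟩
      δ m + suc (suc (2 * c))   ≡⟨ +-suc (δ m) (suc (2 * c)) ⟩
      suc (δ m + suc (2 * c))   ∎)
      where open ≡-Reasoning

  ΔΣ-stable : ∀ {x y x' y'} → ΔΣ x y → TwoQueenDee x y x' y' → ¬ ΔΣ x' y'
  ΔΣ-stable (origin refl refl)           mv = ⊥-elim (no-move-from-origin mv)
  ΔΣ-stable (pair 1≤m δm≡x σm≡y)         mv = pair-stable 1≤m δm≡x σm≡y mv
  ΔΣ-stable (pair-swapped 1≤m σm≡x δm≡y) mv q =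
    pair-stable 1≤m δm≡y σm≡x (TwoQueenDee-swap mv) (ΔΣ-swap q)

  even-gap-move : ∀ {m j} → 1 ≤ m → j < α m →
                  ∃₂ λ x' y' → Reach (δ m) (δ m + 2 * j) x' y' × x' ≢ δ m × ΔΣ x' y'
  even-gap-move {m} {zero} 1≤m _ =
    0 , 0 , Reach-diag z≤n z≤n (sym (+-identityʳ (δ m))) , (λ 0≡δm → n>0⇒n≢0 (δ-pos 1≤m) (sym 0≡δm))
      , origin refl refl
  even-gap-move {m} {j@(suc _)} 1≤m j<αm with α⊎β-cover {j} (s≤s z≤n)
  ... | k , 1≤k , inj₁ αk≡j = δ k , σ k , Reach-diag (<⇒≤ δk<δm) σk≤ gap , <⇒≢ δk<δm , pair 1≤k refl refl
    where
    δk<δm : δ k < δ m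
    δk<δm = δ-increasing 1≤k (α-reflects-< 1≤m (subst (_< α m) (sym αk≡j) j<αm))
    σk≡δk+2j : σ k ≡ δ k + 2 * j
    σk≡δk+2j = trans (σ≡δ+2α 1≤k) (cong (λ a → δ k + 2 * a) αk≡j)
    σk≤ : σ k ≤ δ m + 2 * j
    σk≤ = subst (_≤ δ m + 2 * j) (sym σk≡δk+2j) (+-monoˡ-≤ (2 * j) (<⇒≤ δk<δm))
    gap : δ m ∸ δ k ≡ (δ m + 2 * j) ∸ σ k
    gap = sym (trans (cong (δ m + 2 * j ∸_) σk≡δk+2j) ([m+o]∸[n+o]≡m∸n (δ m) (δ k) (2 * j)))
  ... | k , 1≤k , inj₂ βk≡j = δ k , σ k , Reach-reflL δm<δm+2j (δ-pos 1≤k) δk+σk≡gap , δk≢δm , pair 1≤k refl refl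
    where
    δm<δm+2j : δ m < δ m + 2 * j
    δm<δm+2j = m<m+n (δ m) (≤-trans (s≤s z≤n) (m≤m+n j (j + 0)))
    δk+σk≡gap : δ k + σ k ≡ (δ m + 2 * j) ∸ δ m
    δk+σk≡gap = trans (δ+σ≡2β 1≤k) (trans (cong (2 *_) βk≡j) (sym (m+n∸m≡n (δ m) (2 * j))))
    δk≢δm : δ k ≢ δ m
    δk≢δm δk≡δm with δ-injective 1≤k 1≤m δk≡δm
    ... | refl = <⇒≱ j<αm (subst (α k ≤_) βk≡j (α≤β 1≤k))

  MoveToΔΣ : ℕ → ℕ → Set
  MoveToΔΣ x y = ∃₂ λ x' y' → TwoQueenDee x y x' y' × ΔΣ x' y'

  below-pair⇒<α : ∀ {m j} → 1 ≤ m → δ m + 2 * j < σ m → j < α m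
  below-pair⇒<α {m} {j} 1≤m below = *-cancelˡ-< 2 j (α m)
    (+-cancelˡ-< (δ m) (2 * j) (2 * α m) (subst (δ m + 2 * j <_) (σ≡δ+2α 1≤m) below))

  even-gap-absorbing : ∀ {m j y} → 1 ≤ m → j < α m → Start (δ m) y (δ m) (δ m + 2 * j) →
                       MoveToΔΣ (δ m) y
  even-gap-absorbing 1≤m j<αm start with even-gap-move 1≤m j<αm
  ... | x' , y' , r , x'≢δm , q = x' , y' , queen start r (λ (x'≡δm , _) → x'≢δm x'≡δm) , q

  pair-column-absorbing : ∀ {m y} → 1 ≤ m → δ m ≤ y → ΔΣ (δ m) y ⊎ MoveToΔΣ (δ m) y
  pair-column-absorbing {m} {y} 1≤m δm≤y with <-cmp y (σ m)
  ... | tri≈ _ y≡σm _ = inj₁ (pair 1≤m refl (sym y≡σm))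
  ... | tri> _ _ y>σm = inj₂ (δ m , σ m , down y>σm , pair 1≤m refl refl)
  ... | tri< y<σm _ _ with even⊎odd (y ∸ δ m)
  ...   | j , inj₁ gap≡2j = inj₂ (subst (MoveToΔΣ (δ m)) (sym y≡δm+2j)
                                   (even-gap-absorbing 1≤m j<αm here))
    where
    y≡δm+2j : y ≡ δ m + 2 * j
    y≡δm+2j = trans (sym (m+[n∸m]≡n δm≤y)) (cong (δ m +_) gap≡2j)
    j<αm : j < α m
    j<αm = below-pair⇒<α {j = j} 1≤m (subst (_< σ m) y≡δm+2j y<σm)
  ...   | j , inj₂ gap≡1+2j = inj₂ (subst (MoveToΔΣ (δ m)) (sym y≡1+δm+2j)
                                     (even-gap-absorbing 1≤m j<αm decy))
    where
    y≡1+δm+2j : y ≡ suc (δ m + 2 * j)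
    y≡1+δm+2j = trans (sym (m+[n∸m]≡n δm≤y)) (trans (cong (δ m +_) gap≡1+2j) (+-suc (δ m) (2 * j)))
    j<αm : j < α m
    j<αm = below-pair⇒<α {j = j} 1≤m (<-trans (n<1+n _) (subst (_< σ m) y≡1+δm+2j y<σm))

  ΔΣ-absorbing-≤ : ∀ {x y} → x ≤ y → ΔΣ x y ⊎ MoveToΔΣ x y
  ΔΣ-absorbing-≤ {zero}  {zero}  _   = inj₁ (origin refl refl)
  ΔΣ-absorbing-≤ {zero}  {suc y} _   = inj₂ (0 , 0 , down z<s , origin refl refl)
  ΔΣ-absorbing-≤ {suc x} {y}     x≤y with δ⊎σ-cover {suc x} (s≤s z≤n)
  ... | m , 1≤m , inj₁ δm≡x = subst (λ x → ΔΣ x y ⊎ MoveToΔΣ x y) δm≡x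
                                (pair-column-absorbing 1≤m (subst (_≤ y) (sym δm≡x) x≤y))
  ... | m , 1≤m , inj₂ σm≡x = inj₂ (suc x , δ m , down δm<y , pair-swapped 1≤m σm≡x refl)
    where
    δm<y : δ m < y
    δm<y = <-≤-trans (subst (δ m <_) σm≡x (δ<σ 1≤m)) x≤y

  ΔΣ-absorbing : ∀ x y → ΔΣ x y ⊎ MoveToΔΣ x y
  ΔΣ-absorbing x y with ≤-total x y
  ... | inj₁ x≤y = ΔΣ-absorbing-≤ x≤y
  ... | inj₂ y≤x with ΔΣ-absorbing-≤ y≤x
  ...   | inj₁ q                    = inj₁ (ΔΣ-swap q)
  ...   | inj₂ (x' , y' , move , q) = inj₂ (y' , x' , TwoQueenDee-swap move , ΔΣ-swap q)

  P2⇔ΔΣ : ∀ x y → (P2 x y → ΔΣ x y) × (ΔΣ x y → P2 x y)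
  P2⇔ΔΣ = PPositions.P-characterisation twoQueenDee isP2
            (origin refl refl) ΔΣ-axisʸ ΔΣ-axisˣ ΔΣ-stable ΔΣ-absorbing

  enumerates-P2 : Enumerates P2 δ σ
  enumerates-P2 = (λ _ _ → δ-increasing)
                , (λ n 1≤n → proj₂ (P2⇔ΔΣ (δ n) (σ n)) (pair 1≤n refl refl) , δ-pos 1≤n , <⇒≤ (δ<σ 1≤n))
                , complete
    where
    complete : ∀ x y → P2 x y → 0 < x → x ≤ y → ∃ λ n → 1 ≤ n × δ n ≡ x × σ n ≡ y
    complete x y p 0<x x≤y with proj₁ (P2⇔ΔΣ x y) p
    ... | origin x≡0 _               = ⊥-elim (n>0⇒n≢0 0<x x≡0)
    ... | pair 1≤n δn≡x σn≡y         = _ , 1≤n , δn≡x , σn≡y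
    ... | pair-swapped 1≤n σn≡x δn≡y = ⊥-elim (<⇒≱ (δ<σ 1≤n) (subst₂ _≤_ (sym σn≡x) (sym δn≡y) x≤y))

lemma3 : (PQ P2 : ℕ → ℕ → Set) → IsPPositions QueenDee PQ → IsPPositions TwoQueenDee P2 →
         (α β a b : ℕ → ℕ) → Enumerates PQ α β → Enumerates P2 a b →
         ∀ n → 1 ≤ n →
           (a n ≡ β n ∸ α n) × (b n ≡ β n + α n) ×
           (b n ∸ a n ≡ 2 * α n) × (b n + a n ≡ 2 * β n)
lemma3 PQ P2 isPQ isP2 α β a b enumPQ enumP2 n 1≤n = aₙ≡δₙ , bₙ≡σₙ , bₙ∸aₙ≡2αₙ , bₙ+aₙ≡2βₙ
  where
  open QueenDeePositions isPQ enumPQ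
  open TwoQueenDeePositions isPQ enumPQ isP2 using (enumerates-P2)

  aₙ≡δₙ : a n ≡ δ n
  aₙ≡δₙ = proj₁ (enumeration-unique enumP2 enumerates-P2 n 1≤n)

  bₙ≡σₙ : b n ≡ σ n
  bₙ≡σₙ = proj₂ (enumeration-unique enumP2 enumerates-P2 n 1≤n)

  bₙ∸aₙ≡2αₙ : b n ∸ a n ≡ 2 * α n
  bₙ∸aₙ≡2αₙ = trans (cong₂ _∸_ bₙ≡σₙ aₙ≡δₙ) (σ∸δ≡2α 1≤n)

  bₙ+aₙ≡2βₙ : b n + a n ≡ 2 * β n
  bₙ+aₙ≡2βₙ = trans (cong₂ _+_ bₙ≡σₙ aₙ≡δₙ) (trans (+-comm (σ n) (δ n)) (δ+σ≡2β 1≤n))
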